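{- Let $G=(V,E)$ be a graph with $n$ vertices and no isolated vertices, and let $k$ be an integer with $0\le k\le n$. Then the optimal value of \textsc{max $(k,n-k)$-cut} on $G$ is at least $\min\{n-k,k\}$.
   Context: The optimal value of \textsc{max $(k,n-k)$-cut} on $G$ is the maximum, over all $V'\subseteq V$ with $|V'|=k$, of the number of edges with exactly one endpoint in $V'$. -}

module Defs where

open import Data.Nat using (ℕ; zero; suc; _+_; _≤_; _⊓_)
open import Data.Bool using (Bool; true; false; _xor_; _∧_)
open import Data.Fin using (Fin)
open import Data.Fin.Subset using (Subset; ∣_∣)
open import Data.Vec using (lookup)
open import Data.List using (List; allFin; concatMap; map)
open import Data.Nat.ListAction using (sum)
open import Data.Product using (∃; _×_)
open import Relation.Binary.PropositionalEquality using (_≡_)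

record Graph (n : ℕ) : Set where
  field
    adj        : Fin n → Fin n → Bool
    adj-sym    : ∀ i j → adj i j ≡ adj j i
    adj-irrefl : ∀ i → adj i i ≡ false
open Graph public

NoIsolated : ∀ {n} → Graph n → Set
NoIsolated {n} G = ∀ (v : Fin n) → ∃ λ (w : Fin n) → adj G v w ≡ true

toℕ : Bool → ℕ
toℕ true  = 1
toℕ false = 0

crossing : ∀ {n} → Graph n → Subset n → Fin n → Fin n → Bool
crossing G S i j = adj G i j ∧ (lookup S i xor lookup S j)

-- Each edge {i,j} is an
-- unordered pair; summing over ordered pairs (i,j) counts every edge twice,
-- so we count only ordered pairs with the endpoint i in S (then j ∉ S):
-- each crossing edge is counted exactly once.
cutValue : ∀ {n} → Graph n → Subset n → ℕ
cutValue {n} G S =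
  sum (concatMap (λ i → map (λ j → toℕ (lookup S i ∧ crossing G S i j)) (allFin n)) (allFin n))

-- "The optimal value of max (k,n-k)-cut on G is at least m":
-- the maximum over V' ⊆ V with |V'| = k of the cut value is ≥ m, i.e.
-- some V' with |V'| = k attains cut value ≥ m.
MaxCutAtLeast : ∀ {n} → Graph n → ℕ → ℕ → Set
MaxCutAtLeast {n} G k m = ∃ λ (S : Subset n) → (∣ S ∣ ≡ k) × (m ≤ cutValue G S)

-- Call a bipartition (D, ∁ D) covering if every vertex has a neighbour on the
-- other side. Without isolated vertices a covering bipartition exists: while some
-- vertex v has all its neighbours on its own side, move v across; this strictly
-- decreases the number of monochromatic edges, so the process stops.
-- If k ≤ ∣D∣, any k-subset of D has every vertex adjacent to a vertex outside D,
-- hence a cut of size at least k. Otherwise n ∸ k ≤ ∣∁ D∣, the same argument gives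
-- an (n ∸ k)-set with cut at least n ∸ k, and its complement has the same cut.
module Submission where

open import Defs
open import Data.Bool using (Bool; true; false; not; _xor_; _∧_)
open import Data.Bool.Properties
  using (¬-not; not-¬; ∧-zeroʳ; not-involutive; not-distribˡ-xor; not-distribʳ-xor; xor-comm)
  renaming (_≟_ to _≟ᵇ_)
open import Data.Fin using (Fin; zero; suc; _≟_)
open import Data.Fin.Properties using (any?; all?; ¬∀⟶∃¬)
open import Data.Fin.Subset using (Subset; ∣_∣; ∁; _⊆_; ⊥; inside; outside)
open import Data.Fin.Subset.Properties using (∣∁p∣≡n∸∣p∣; ⊥⊆; ∣⊥∣≡0; out⊆; in⊆in)
open import Data.List using (List; allFin; concatMap; map; tabulate)
  renaming ([] to []ˡ; _∷_ to _∷ˡ_)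
open import Data.List.Properties using (map-tabulate)
open import Data.Nat using (ℕ; zero; suc; _+_; _≤_; _<_; _∸_; _⊓_; z≤n; s≤s; _≤?_)
open import Data.Nat.Induction using (<-wellFounded)
open import Data.Nat.ListAction using (sum)
open import Data.Nat.ListAction.Properties using (sum-++)
open import Data.Nat.Properties
  using ( +-0-commutativeMonoid; +-mono-≤; +-mono-<-≤; +-mono-≤-<; m≤m+n; m≤n+m
        ; ≤-trans; ≤-reflexive; <⇒≤; ≰⇒>; ∸-monoʳ-≤; m∸[m∸n]≡n; m⊓n≤m; m⊓n≤n
        ; module ≤-Reasoning )
open import Data.Product using (∃; _×_; _,_)
open import Data.Vec using ([]; _∷_; lookup; _[_]%=_)
open import Data.Vec.Properties
  using (lookup∘updateAt; lookup∘updateAt′; lookup-map; []=⇒lookup; lookup⇒[]=)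
open import Function using (_∘_; id)
open import Induction.WellFounded using (Acc; acc)
open import Relation.Nullary using (Dec; yes; no; contradiction)
open import Relation.Binary.PropositionalEquality
open import Algebra.Properties.CommutativeMonoid.Sum +-0-commutativeMonoid
  using (∑-comm; sum-cong-≗) renaming (sum to ∑)

private
  variable
    n k m m′ : ℕ

sum-concatMap : {A : Set} (f : A → List ℕ) (xs : List A) →
                sum (concatMap f xs) ≡ sum (map (sum ∘ f) xs)
sum-concatMap f []ˡ       = refl
sum-concatMap f (x ∷ˡ xs) = trans (sum-++ (f x) _) (cong (sum (f x) +_) (sum-concatMap f xs))

sum-tabulate : (f : Fin n → ℕ) → sum (tabulate f) ≡ ∑ f
sum-tabulate {zero}  f = refl
sum-tabulate {suc n} f = cong (f zero +_) (sum-tabulate (f ∘ suc))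

sum-map-allFin : (f : Fin n → ℕ) → sum (map f (allFin n)) ≡ ∑ f
sum-map-allFin f = trans (cong sum (map-tabulate id f)) (sum-tabulate f)

∑-mono-≤ : {f g : Fin n → ℕ} → (∀ i → f i ≤ g i) → ∑ f ≤ ∑ g
∑-mono-≤ {zero}  f≤g = z≤n
∑-mono-≤ {suc n} f≤g = +-mono-≤ (f≤g zero) (∑-mono-≤ (f≤g ∘ suc))

∑-mono-< : {f g : Fin n → ℕ} → (∀ i → f i ≤ g i) → ∀ i → f i < g i → ∑ f < ∑ g
∑-mono-< f≤g zero    f<g = +-mono-<-≤ f<g (∑-mono-≤ (f≤g ∘ suc))
∑-mono-< f≤g (suc i) f<g = +-mono-≤-< (f≤g zero) (∑-mono-< (f≤g ∘ suc) i f<g)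

term≤∑ : (f : Fin n → ℕ) (i : Fin n) → f i ≤ ∑ f
term≤∑ f zero    = m≤m+n _ _
term≤∑ f (suc i) = ≤-trans (term≤∑ (f ∘ suc) i) (m≤n+m _ _)

∣p∣≡∑toℕ : (p : Subset n) → ∣ p ∣ ≡ ∑ (toℕ ∘ lookup p)
∣p∣≡∑toℕ []            = refl
∣p∣≡∑toℕ (inside  ∷ p) = cong suc (∣p∣≡∑toℕ p)
∣p∣≡∑toℕ (outside ∷ p) = ∣p∣≡∑toℕ p

⊆⇒lookup : {p q : Subset n} {i : Fin n} → p ⊆ q → lookup p i ≡ true → lookup q i ≡ true
⊆⇒lookup {p = p} {i = i} p⊆q i∈p = []=⇒lookup (p⊆q (lookup⇒[]= i p i∈p))

⊆-ofSize : (p : Subset n) → k ≤ ∣ p ∣ → ∃ λ q → q ⊆ p × ∣ q ∣ ≡ k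
⊆-ofSize {n} {zero} p _ = ⊥ , ⊥⊆ , ∣⊥∣≡0 n
⊆-ofSize {k = suc k} (outside ∷ p) k<∣p∣ with ⊆-ofSize p k<∣p∣
... | q , q⊆p , ∣q∣≡k = outside ∷ q , out⊆ q⊆p , ∣q∣≡k
⊆-ofSize {k = suc k} (inside ∷ p) (s≤s k≤∣p∣) with ⊆-ofSize p k≤∣p∣
... | q , q⊆p , ∣q∣≡k = inside ∷ q , in⊆in q⊆p , cong suc ∣q∣≡k

∧-xor≡true : ∀ {a x y} → a ∧ (x xor y) ≡ true → a ≡ true × y ≡ not x
∧-xor≡true {true} {true}  {false} _ = refl , refl
∧-xor≡true {true} {false} {true}  _ = refl , refl
∧-xor≡true {true} {true}  {true}  ()
∧-xor≡true {true} {false} {false} ()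
∧-xor≡true {false}                ()

crossing-sym : (G : Graph n) (S : Subset n) (i j : Fin n) →
               crossing G S i j ≡ crossing G S j i
crossing-sym G S i j = cong₂ _∧_ (adj-sym G i j) (xor-comm (lookup S i) (lookup S j))

crossing-∁ : (G : Graph n) (S : Subset n) (i j : Fin n) →
             crossing G (∁ S) i j ≡ crossing G S i j
crossing-∁ G S i j rewrite lookup-map i not S | lookup-map j not S =
  cong (adj G i j ∧_) (not-xor-not (lookup S i) (lookup S j))
  where
  not-xor-not : ∀ x y → not x xor not y ≡ x xor y
  not-xor-not true  y = refl
  not-xor-not false y = not-involutive y

crossing-⊆ : {G : Graph n} {T S : Subset n} {i w : Fin n} → T ⊆ S →
             lookup T i ≡ true → crossing G S i w ≡ true → crossing G T i w ≡ true
crossing-⊆ {T = T} {w = w} T⊆S i∈T iw with ∧-xor≡true iw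
... | a , Sw≡not-Si = cong₂ _∧_ a (cong₂ _xor_ i∈T w∉T)
  where
  w∉T : lookup T w ≡ false
  w∉T = ¬-not λ w∈T →
    not-¬ (⊆⇒lookup T⊆S w∈T) (trans Sw≡not-Si (cong not (⊆⇒lookup T⊆S i∈T)))

outgoing : Graph n → Subset n → Fin n → Fin n → ℕ
outgoing G S i j = toℕ (lookup S i ∧ crossing G S i j)

cutValue-∑ : (G : Graph n) (S : Subset n) →
             cutValue G S ≡ ∑ λ i → ∑ λ j → outgoing G S i j
cutValue-∑ {n} G S = begin
  cutValue G S                                  ≡⟨ sum-concatMap row (allFin n) ⟩
  sum (map (sum ∘ row) (allFin n))              ≡⟨ sum-map-allFin (sum ∘ row) ⟩
  ∑ (sum ∘ row)                                 ≡⟨ sum-cong-≗ (sum-map-allFin ∘ outgoing G S) ⟩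
  (∑ λ i → ∑ λ j → outgoing G S i j)            ∎
  where
  open ≡-Reasoning
  row : Fin n → List ℕ
  row i = map (outgoing G S i) (allFin n)

outgoing-∁ : (G : Graph n) (S : Subset n) (i j : Fin n) →
             outgoing G (∁ S) i j ≡ outgoing G S j i
outgoing-∁ G S i j rewrite crossing-∁ G S i j | crossing-sym G S i j | lookup-map i not S =
  cong toℕ (same-side (lookup S i) (lookup S j) (adj G j i))
  where
  same-side : ∀ a b c → not a ∧ (c ∧ (b xor a)) ≡ b ∧ (c ∧ (b xor a))
  same-side true  true  c = sym (∧-zeroʳ c)
  same-side true  false c = refl
  same-side false true  c = refl
  same-side false false c = ∧-zeroʳ c

cutValue-∁ : (G : Graph n) (S : Subset n) → cutValue G (∁ S) ≡ cutValue G S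
cutValue-∁ G S = begin
  cutValue G (∁ S)                               ≡⟨ cutValue-∑ G (∁ S) ⟩
  (∑ λ i → ∑ λ j → outgoing G (∁ S) i j)         ≡⟨ sum-cong-≗ (sum-cong-≗ ∘ outgoing-∁ G S) ⟩
  (∑ λ i → ∑ λ j → outgoing G S j i)             ≡⟨ ∑-comm (λ i j → outgoing G S j i) ⟩
  (∑ λ j → ∑ λ i → outgoing G S j i)             ≡⟨ cutValue-∑ G S ⟨
  cutValue G S                                   ∎
  where open ≡-Reasoning

toℕ≤ : ∀ b {m} → (b ≡ true → 1 ≤ m) → toℕ b ≤ m
toℕ≤ false _   = z≤n
toℕ≤ true  1≤m = 1≤m refl

false⇒toℕ≤ : ∀ {b m} → b ≡ false → toℕ b ≤ m
false⇒toℕ≤ refl = z≤n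

∣S∣≤cutValue : (G : Graph n) (S : Subset n) →
               (∀ i → lookup S i ≡ true → ∃ λ w → crossing G S i w ≡ true) →
               ∣ S ∣ ≤ cutValue G S
∣S∣≤cutValue G S leaves = begin
  ∣ S ∣                                  ≡⟨ ∣p∣≡∑toℕ S ⟩
  ∑ (toℕ ∘ lookup S)                     ≤⟨ ∑-mono-≤ row ⟩
  (∑ λ i → ∑ λ j → outgoing G S i j)     ≡⟨ cutValue-∑ G S ⟨
  cutValue G S                           ∎
  where
  open ≤-Reasoning
  row : ∀ i → toℕ (lookup S i) ≤ ∑ (outgoing G S i)
  row i = toℕ≤ (lookup S i) λ i∈S → let w , iw = leaves i i∈S in
    ≤-trans (≤-reflexive (cong toℕ (sym (cong₂ _∧_ i∈S iw)))) (term≤∑ (outgoing G S i) w)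

CoveringCut : Graph n → Subset n → Set
CoveringCut {n} G S = ∀ (v : Fin n) → ∃ λ w → crossing G S v w ≡ true

CoveringCut-∁ : (G : Graph n) (S : Subset n) → CoveringCut G S → CoveringCut G (∁ S)
CoveringCut-∁ G S covers v with covers v
... | w , vw = w , trans (crossing-∁ G S v w) vw

CoveringCut⇒MaxCutAtLeast : (G : Graph n) (D : Subset n) →
                            CoveringCut G D → k ≤ ∣ D ∣ → MaxCutAtLeast G k k
CoveringCut⇒MaxCutAtLeast G D covers k≤∣D∣ with ⊆-ofSize D k≤∣D∣
... | T , T⊆D , ∣T∣≡k = T , ∣T∣≡k , subst (_≤ cutValue G T) ∣T∣≡k (∣S∣≤cutValue G T leaves)
  where
  leaves : ∀ i → lookup T i ≡ true → ∃ λ w → crossing G T i w ≡ true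
  leaves i i∈T with covers i
  ... | w , iw = w , crossing-⊆ {G = G} T⊆D i∈T iw

toggle : Subset n → Fin n → Subset n
toggle S v = S [ v ]%= not

toggle-xorˡ : (S : Subset n) {v j : Fin n} → j ≢ v →
              lookup (toggle S v) v xor lookup (toggle S v) j ≡ not (lookup S v xor lookup S j)
toggle-xorˡ S {v} {j} j≢v rewrite lookup∘updateAt v {not} S | lookup∘updateAt′ j v {not} j≢v S =
  sym (not-distribˡ-xor (lookup S v) (lookup S j))

toggle-xorʳ : (S : Subset n) {v i : Fin n} → i ≢ v →
              lookup (toggle S v) i xor lookup (toggle S v) v ≡ not (lookup S i xor lookup S v)
toggle-xorʳ S {v} {i} i≢v rewrite lookup∘updateAt v {not} S | lookup∘updateAt′ i v {not} i≢v S =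
  sym (not-distribʳ-xor (lookup S i) (lookup S v))

toggle-xor-away : (S : Subset n) {v i j : Fin n} → i ≢ v → j ≢ v →
                  lookup (toggle S v) i xor lookup (toggle S v) j ≡ lookup S i xor lookup S j
toggle-xor-away S {v} {i} {j} i≢v j≢v =
  cong₂ _xor_ (lookup∘updateAt′ i v i≢v S) (lookup∘updateAt′ j v j≢v S)

monochromatic : Graph n → Subset n → Fin n → Fin n → Bool
monochromatic G S i j = adj G i j ∧ not (lookup S i xor lookup S j)

monochromaticEdges : Graph n → Subset n → ℕ
monochromaticEdges G S = ∑ λ i → ∑ λ j → toℕ (monochromatic G S i j)

monochromatic-loop : (G : Graph n) (S : Subset n) (i : Fin n) → monochromatic G S i i ≡ false
monochromatic-loop G S i = cong (_∧ _) (adj-irrefl G i)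

monochromatic-flipped : (G : Graph n) (S S′ : Subset n) {i j : Fin n} →
  lookup S′ i xor lookup S′ j ≡ not (lookup S i xor lookup S j) →
  monochromatic G S′ i j ≡ crossing G S i j
monochromatic-flipped G S S′ {i} {j} flipped =
  cong (adj G i j ∧_) (trans (cong not flipped) (not-involutive _))

monochromatic-uncrossed : (G : Graph n) (S : Subset n) {i j : Fin n} →
  adj G i j ≡ true → crossing G S i j ≡ false → monochromatic G S i j ≡ true
monochromatic-uncrossed G S {i} {j} ij uncrossed = cong₂ (λ a x → a ∧ not x) ij same
  where
  same : lookup S i xor lookup S j ≡ false
  same = trans (cong (_∧ (lookup S i xor lookup S j)) (sym ij)) uncrossed

module _ {G : Graph n} {S : Subset n} {v : Fin n}
         (uncovered : ∀ w → crossing G S v w ≡ false) where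

  open ≡-Reasoning

  toggle-monochromatic-≤ : ∀ i j →
    toℕ (monochromatic G (toggle S v) i j) ≤ toℕ (monochromatic G S i j)
  toggle-monochromatic-≤ i j with i ≟ v | j ≟ v
  ... | yes refl | yes refl = false⇒toℕ≤ (monochromatic-loop G (toggle S v) v)
  ... | yes refl | no j≢v   = false⇒toℕ≤ (begin
    monochromatic G (toggle S v) v j  ≡⟨ monochromatic-flipped G S (toggle S v) (toggle-xorˡ S j≢v) ⟩
    crossing G S v j                  ≡⟨ uncovered j ⟩
    false                             ∎)
  ... | no i≢v   | yes refl = false⇒toℕ≤ (begin
    monochromatic G (toggle S v) i v  ≡⟨ monochromatic-flipped G S (toggle S v) (toggle-xorʳ S i≢v) ⟩
    crossing G S i v                  ≡⟨ crossing-sym G S i v ⟩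
    crossing G S v i                  ≡⟨ uncovered i ⟩
    false                             ∎)
  ... | no i≢v   | no j≢v   =
    ≤-reflexive (cong (λ x → toℕ (adj G i j ∧ not x)) (toggle-xor-away S i≢v j≢v))

  toggle-decreases : NoIsolated G → monochromaticEdges G (toggle S v) < monochromaticEdges G S
  toggle-decreases noIsolated with noIsolated v
  ... | w , vw = ∑-mono-< (∑-mono-≤ ∘ toggle-monochromatic-≤) v
                   (∑-mono-< (toggle-monochromatic-≤ v) w strict)
    where
    w≢v : w ≢ v
    w≢v refl = contradiction (trans (sym vw) (adj-irrefl G v)) λ ()
    toggled : monochromatic G (toggle S v) v w ≡ false
    toggled = trans (monochromatic-flipped G S (toggle S v) (toggle-xorˡ S w≢v)) (uncovered w)
    strict : toℕ (monochromatic G (toggle S v) v w) < toℕ (monochromatic G S v w)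
    strict rewrite toggled | monochromatic-uncrossed G S vw (uncovered w) = s≤s z≤n

coveringCut-exists : (G : Graph n) → NoIsolated G → ∃ (CoveringCut G)
coveringCut-exists {n} G noIsolated = search ⊥ (<-wellFounded _)
  where
  covered? : ∀ S v → Dec (∃ λ w → crossing G S v w ≡ true)
  covered? S v = any? λ w → crossing G S v w ≟ᵇ true

  search : (S : Subset n) → Acc _<_ (monochromaticEdges G S) → ∃ (CoveringCut G)
  search S (acc smaller) with all? (covered? S)
  ... | yes covers = S , covers
  ... | no ¬covers with ¬∀⟶∃¬ n _ (covered? S) ¬covers
  ...   | v , uncovered = search (toggle S v)
          (smaller (toggle-decreases {G = G} {S} {v} (λ w → ¬-not (uncovered ∘ (w ,_))) noIsolated))

MaxCutAtLeast-weaken : (G : Graph n) → m′ ≤ m → MaxCutAtLeast G k m → MaxCutAtLeast G k m′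
MaxCutAtLeast-weaken G m′≤m (S , ∣S∣≡k , m≤cut) = S , ∣S∣≡k , ≤-trans m′≤m m≤cut

MaxCutAtLeast-∁ : (G : Graph n) → k ≤ n → MaxCutAtLeast G (n ∸ k) m → MaxCutAtLeast G k m
MaxCutAtLeast-∁ {n} {k} G k≤n (S , ∣S∣≡n∸k , m≤cut) =
  ∁ S , ∣∁S∣≡k , subst (_ ≤_) (sym (cutValue-∁ G S)) m≤cut
  where
  ∣∁S∣≡k : ∣ ∁ S ∣ ≡ k
  ∣∁S∣≡k = trans (∣∁p∣≡n∸∣p∣ S) (trans (cong (n ∸_) ∣S∣≡n∸k) (m∸[m∸n]≡n k≤n))

corollary14 : (n : ℕ) (G : Graph n) → NoIsolated G →
              (k : ℕ) → k ≤ n →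
              MaxCutAtLeast G k ((n ∸ k) ⊓ k)
corollary14 n G noIsolated k k≤n with coveringCut-exists G noIsolated
... | D , covers with k ≤? ∣ D ∣
...   | yes k≤∣D∣ = MaxCutAtLeast-weaken G (m⊓n≤n (n ∸ k) k)
                      (CoveringCut⇒MaxCutAtLeast G D covers k≤∣D∣)
...   | no k≰∣D∣  = MaxCutAtLeast-weaken G (m⊓n≤m (n ∸ k) k) (MaxCutAtLeast-∁ G k≤n
                      (CoveringCut⇒MaxCutAtLeast G (∁ D) (CoveringCut-∁ G D covers) n∸k≤∣∁D∣))
  where
  n∸k≤∣∁D∣ : n ∸ k ≤ ∣ ∁ D ∣
  n∸k≤∣∁D∣ = subst (n ∸ k ≤_) (sym (∣∁p∣≡n∸∣p∣ D)) (∸-monoʳ-≤ n (<⇒≤ (≰⇒> k≰∣D∣)))
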